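{- Let $\mathcal{B}$, $\mathbb{P}$ be as in the context. Every trajectory of full rank is either a corner trajectory or a rigid cycle.
   Context: $\mathcal{B}\subset\mathbb{R}^2$ is a convex polygon with rational corners, interior $\mathcal{B}^\circ$, boundary $\partial\mathcal{B}$, sides on lines $\alpha_1x+\alpha_2y=\beta$. $\mathbb{P}$ is a two-move rider with nonparallel moves $\mathbf{m}_r=(c_r,d_r)$, $r=1,2$, with relatively prime integer coordinates. For $\mathbf{z}=(\mathbf{z}_1,\dots,\mathbf{z}_k)\in\mathbb{R}^{2k}$, $\mathcal{H}(\mathbf{z})$ is the set of hyperplanes containing $\mathbf{z}$ among attack equations $(\mathbf{z}_i-\mathbf{z}_j)\cdot(d_r,-c_r)=0$ ($i\ne j$) and fixations $(\alpha_1,\alpha_2)\cdot\mathbf{z}_i=\beta$ (sides of $\mathcal{B}$); $\mathbf{z}$ has full rank if the linear system $\mathcal{H}(\mathbf{z})$ has rank $2k$. Antipode maps: $s_r(\mathbf{b})=\mathbf{b}$ if the line $\{\mathbf{b}+\lambda\mathbf{m}_r\}$ misses $\mathcal{B}^\circ$, else the other point where it meets $\partial\mathcal{B}$. An extended trajectory is a maximal sequence $(\mathbf{b}_i)$ in $\partial\mathcal{B}$ with $\mathbf{b}_{i+1}=s_{r_i}(\mathbf{b}_i)\ne\mathbf{b}_i$, $r_i$ alternating between $1$ and $2$. A trajectory $T=[\mathbf{b}_1,\dots,\mathbf{b}_l]$ is a finite consecutive subsequence of distinct points of an extended trajectory; it has full rank if $(\mathbf{b}_1,\dots,\mathbf{b}_l)$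 does. A corner trajectory contains a corner of $\mathcal{B}$. A cyclical trajectory consists of $p$ consecutive points of an extended trajectory periodic with minimal period $p\ge2$; a rigid cycle is a cyclical trajectory of full rank.
   Formalization: Points of the plane have coordinates in ℚ instead of $\mathbb{R}$, so trajectories, extended trajectories, corners of $\mathcal{B}$ and the vectors tested for full rank are all rational. -}

module Defs where

open import Data.Nat as ℕ using (ℕ)
open import Data.Nat.Coprimality using (Coprime)
open import Data.Integer as ℤ using (ℤ)
open import Data.Rational as ℚ using (ℚ; 0ℚ; _≤_; _<_; _*_; _+_; _-_)
open import Data.Fin using (Fin; zero; suc; toℕ)
open import Data.Maybe using (Maybe; just; nothing)
open import Data.Product using (Σ; ∃; _×_; _,_)
open import Data.Sum using (_⊎_)
open import Data.Unit using (⊤)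
open import Relation.Binary.PropositionalEquality using (_≡_; _≢_)
open import Relation.Nullary using (¬_)
open import Function using (Injective)

Point : Set
Point = ℚ × ℚ

origin : Point
origin = (0ℚ , 0ℚ)

_·_ : Point → Point → ℚ
(a , b) · (x , y) = a * x + b * y

_⊕_ : Point → Point → Point
(a , b) ⊕ (x , y) = (a + x , b + y)

_⊖_ : Point → Point → Point
(a , b) ⊖ (x , y) = (a - x , b - y)

_⊛_ : ℚ → Point → Point
λ' ⊛ (x , y) = (λ' * x , λ' * y)

½ : ℚ
½ = ℤ.+ 1 ℚ./ 2

fromℤ : ℤ → ℚ
fromℤ z = z ℚ./ 1

-- Convex polygon given by its sides: side i lies on the line α i · x = β i,
-- and B = { x | α i · x ≤ β i for all i }.

InHP : {n : ℕ} → (Fin n → Point) → (Fin n → ℚ) → Point → Set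
InHP α β x = ∀ i → α i · x ≤ β i

record Polygon : Set where
  field
    n : ℕ
    α : Fin n → Point
    β : Fin n → ℚ
    α≢0 : ∀ i → α i ≢ origin
    bounded : ∃ λ (M : ℚ) → ∀ x → InHP α β x →
              ℚ.∣ Data.Product.proj₁ x ∣ ≤ M × ℚ.∣ Data.Product.proj₂ x ∣ ≤ M
    interiorNonempty : ∃ λ x → ∀ i → α i · x < β i
    -- every listed line really carries a side of B (meets B in ≥ 2 points)
    genuineSide : ∀ i → ∃ λ x → ∃ λ y → InHP α β x × InHP α β y × x ≢ y ×
                  α i · x ≡ β i × α i · y ≡ β i

module _ (B : Polygon) where
  open Polygon B

  InB : Point → Set
  InB = InHP α β

  Interior : Point → Set
  Interior x = ∀ i → α i · x < β i

  Boundary : Point → Set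
  Boundary x = InB x × ∃ λ i → α i · x ≡ β i

  Corner : Point → Set
  Corner x = InB x × (∀ y z → InB y → InB z → x ≡ ½ ⊛ (y ⊕ z) → y ≡ z)

record Rider : Set where
  field
    c d : Fin 2 → ℤ
    coprime : ∀ r → Coprime ℤ.∣ c r ∣ ℤ.∣ d r ∣
    nonparallel : c zero ℤ.* d (suc zero)
                  ≢ c (suc zero) ℤ.* d zero
  mv : Fin 2 → Point
  mv r = (fromℤ (c r) , fromℤ (d r))
  -- normal vector (d_r , - c_r) of the attack lines
  nrm : Fin 2 → Point
  nrm r = (fromℤ (d r) , fromℤ (ℤ.- c r))

module _ (B : Polygon) (P : Rider) where
  open Polygon B
  open Rider P

  LineMeetsInterior : Fin 2 → Point → Set
  LineMeetsInterior r b = ∃ λ (μ : ℚ) → Interior B (b ⊕ (μ ⊛ mv r))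

  -- s_r(b) ≡ b'   (for b ∈ ∂B), written as a relation
  Antipode : Fin 2 → Point → Point → Set
  Antipode r b b' = Boundary B b ×
    ((¬ LineMeetsInterior r b × b' ≡ b) ⊎
     (LineMeetsInterior r b × Boundary B b' × b' ≢ b ×
      ∃ λ (λ' : ℚ) → b' ≡ b ⊕ (λ' ⊛ mv r)))

  Step : Fin 2 → Point → Point → Set
  Step r b b' = Antipode r b b' × b' ≢ b

  -- index intervals of ℤ: lower/upper bounds, nothing = ∓∞
  LoOK : Maybe ℤ → ℤ → Set
  LoOK nothing  i = ⊤
  LoOK (just l) i = l ℤ.≤ i

  HiOK : Maybe ℤ → ℤ → Set
  HiOK nothing  i = ⊤
  HiOK (just h) i = i ℤ.≤ h

  record ExtendedTrajectory : Set where
    field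
      lo hi : Maybe ℤ
      pt : ℤ → Point
      rr : ℤ → Fin 2     -- rr i : the move index taking pt i to pt (i+1)
    InI : ℤ → Set
    InI i = LoOK lo i × HiOK hi i
    field
      nonempty : ∃ λ i → InI i
      onBoundary : ∀ i → InI i → Boundary B (pt i)
      step : ∀ i → InI i → InI (i ℤ.+ ℤ.1ℤ) → Step (rr i) (pt i) (pt (i ℤ.+ ℤ.1ℤ))
      alternating : ∀ i → InI i → InI (i ℤ.+ ℤ.1ℤ) → InI (i ℤ.+ ℤ.+ 2) →
                    rr (i ℤ.+ ℤ.1ℤ) ≢ rr i
      -- maximality: no admissible extension beyond a finite end
      maxHi : ∀ h → hi ≡ just h → ∀ r b' →
              (InI (h ℤ.- ℤ.1ℤ) → r ≢ rr (h ℤ.- ℤ.1ℤ)) → ¬ Step r (pt h) b'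
      maxLo : ∀ l → lo ≡ just l → ∀ r b' →
              (InI (l ℤ.+ ℤ.1ℤ) → r ≢ rr l) → ¬ Step r b' (pt l)

  open ExtendedTrajectory

  IsTrajectory : (l : ℕ) → (Fin l → Point) → Set
  IsTrajectory l t = 1 ℕ.≤ l × Injective _≡_ _≡_ t ×
    Σ ExtendedTrajectory λ E → ∃ λ (k : ℤ) →
      ∀ (i : Fin l) → InI E (k ℤ.+ ℤ.+ toℕ i) × pt E (k ℤ.+ ℤ.+ toℕ i) ≡ t i

  IsCornerTrajectory : (l : ℕ) → (Fin l → Point) → Set
  IsCornerTrajectory l t = ∃ λ (i : Fin l) → Corner B (t i)

  HasPeriod : ExtendedTrajectory → ℕ → Set
  HasPeriod E p = ∀ i → pt E (i ℤ.+ ℤ.+ p) ≡ pt E i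

  HasMinimalPeriod : ExtendedTrajectory → ℕ → Set
  HasMinimalPeriod E p = 1 ℕ.≤ p × HasPeriod E p ×
    (∀ q → 1 ℕ.≤ q → q ℕ.< p → ¬ HasPeriod E q)

  IsCyclical : (l : ℕ) → (Fin l → Point) → Set
  IsCyclical l t = 2 ℕ.≤ l × Σ ExtendedTrajectory λ E →
    lo E ≡ nothing × hi E ≡ nothing × HasMinimalPeriod E l ×
    ∃ λ (k : ℤ) → ∀ (i : Fin l) → pt E (k ℤ.+ ℤ.+ toℕ i) ≡ t i

  SolvesH : (k : ℕ) → (Fin k → Point) → (Fin k → Point) → Set
  SolvesH k z v =
    (∀ i j r → i ≢ j → (z i ⊖ z j) · nrm r ≡ 0ℚ → (v i ⊖ v j) · nrm r ≡ 0ℚ) ×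
    (∀ i s → α s · z i ≡ β s → α s · v i ≡ 0ℚ)

  -- z has full rank: the system 𝓗(z) in 2k unknowns has rank 2k,
  -- i.e. its homogeneous version has only the trivial solution
  FullRank : (k : ℕ) → (Fin k → Point) → Set
  FullRank k z = ∀ v → SolvesH k z v → ∀ i → v i ≡ origin

  IsRigidCycle : (l : ℕ) → (Fin l → Point) → Set
  IsRigidCycle l t = IsCyclical l t × FullRank l t

{-# OPTIONS --safe #-}
-- If no point of T is a corner, all sides of B through a point of T are parallel, so every point
-- has a well-defined tangent direction. A line through the interior meets the boundary in only two
-- points, so the only attacks among the points of T are its steps, plus possibly an attack between
-- the two endpoints along the move not used by the first step. Transporting the tangent at the first
-- point along the steps, each step's attack equation determines the next vector as a multiple of the
-- next tangent (the step's line crosses the side, as it enters the interior). If the endpoint chord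
-- runs through the interior, it is one more step and T closes up into a periodic extended trajectory,
-- i.e. a rigid cycle. Otherwise the chord lies on a side, which the transported vectors then also
-- respect; they form a nonzero solution of 𝓗(T), contradicting full rank.
module Submission where

open import Data.Empty using (⊥; ⊥-elim)
open import Data.Fin as Fin using (Fin; zero; suc; toℕ; fromℕ<)
import Data.Fin.Properties as Fin
open import Data.Integer as ℤ using (ℤ)
import Data.Integer.Properties as ℤ
open import Data.Maybe using (nothing)
open import Data.Nat as ℕ using (ℕ; zero; suc; z≤n; s≤s)
import Data.Nat.Coprimality as Coprimality
open import Data.Nat.GeneralisedArithmetic using (fold; fold-+)
import Data.Nat.Properties as ℕ
open import Data.Product as Product using (_×_; _,_; proj₁; proj₂; ∃; swap)
open import Data.Rational as ℚ using (ℚ; mkℚ; 0ℚ; 1ℚ; _+_; _*_; _-_; -_; _≤_; _<_; 1/_)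
import Data.Rational.Properties as ℚ
open import Data.Rational.Solver using (module +-*-Solver)
open import Data.Sum as Sum using (_⊎_; inj₁; inj₂)
open import Function using (Injective; _∘_)
open import Relation.Binary.Definitions using (Tri; tri<; tri≈; tri>)
open import Relation.Binary.PropositionalEquality
open import Relation.Nullary using (¬_; yes; no; Dec)
open import Relation.Nullary.Decidable using (decidable-stable; _×-dec_; ¬?; map′)
open import Relation.Nullary.Negation using (contradiction)
open import Algebra.Apartness.Properties.HeytingCommutativeRing ℚ.heytingCommutativeRing
  using (x#0y#0→xy#0)
open import Algebra.Properties.Group ℚ.+-0-group using (x∙y⁻¹≈ε⇒x≈y; x≈y⇒x∙y⁻¹≈ε)

open import Defs

open +-*-Solver using (solve; _:=_; _:+_; _:*_; _:-_; :-_; con)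
open ≡-Reasoning

p≢0∧p*q≡0⇒q≡0 : ∀ {p q} → p ≢ 0ℚ → p * q ≡ 0ℚ → q ≡ 0ℚ
p≢0∧p*q≡0⇒q≡0 {q = q} p≢0 pq≡0 =
  decidable-stable (q ℚ.≟ 0ℚ) (λ q≢0 → x#0y#0→xy#0 p≢0 q≢0 pq≡0)

-- The reciprocal made total, with junk value 0 at 0.
recip : ℚ → ℚ
recip p with p ℚ.≟ 0ℚ
... | yes _   = 0ℚ
... | no p≢0 = (1/ p) {{ℚ.≢-nonZero p≢0}}

p*recip[q]*q≡p : ∀ p q → q ≢ 0ℚ → p * recip q * q ≡ p
p*recip[q]*q≡p p q q≢0 with q ℚ.≟ 0ℚ
... | yes q≡0 = contradiction q≡0 q≢0
... | no q≢0′ = begin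
  p * (1/ q) * q    ≡⟨ ℚ.*-assoc p _ q ⟩
  p * ((1/ q) * q)  ≡⟨ cong (p *_) (ℚ.*-inverseˡ q) ⟩
  p * 1ℚ            ≡⟨ ℚ.*-identityʳ p ⟩
  p                 ∎
  where instance _ = ℚ.≢-nonZero q≢0′

½*[p+q]≤r : ∀ {p q r} → p ≤ r → q ≤ r → ½ * (p + q) ≤ r
½*[p+q]≤r {p} {q} {r} p≤r q≤r =
  subst (½ * (p + q) ≤_) (sym (r≡½*[r+r] r)) (ℚ.*-monoˡ-≤-nonNeg ½ (ℚ.+-mono-≤ p≤r q≤r))
  where
  r≡½*[r+r] : ∀ r → r ≡ ½ * (r + r)
  r≡½*[r+r] = solve 1 (λ r → r := con ½ :* (r :+ r)) refl

½*[p+q]≡r⇒p≡r : ∀ {p q r} → p ≤ r → q ≤ r → ½ * (p + q) ≡ r → p ≡ r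
½*[p+q]≡r⇒p≡r {p} {q} {r} p≤r q≤r mid≡r with ℚ.<-cmp p r
... | tri≈ _ p≡r _ = p≡r
... | tri> _ _ r<p = contradiction (ℚ.<-≤-trans r<p p≤r) (ℚ.<-irrefl refl)
... | tri< p<r _ _ = contradiction p+q≡r+r (ℚ.<⇒≢ (ℚ.+-mono-<-≤ p<r q≤r))
  where
  halves : ∀ p q → p + q ≡ ½ * (p + q) + ½ * (p + q)
  halves = solve 2 (λ p q → p :+ q := con ½ :* (p :+ q) :+ con ½ :* (p :+ q)) refl
  p+q≡r+r : p + q ≡ r + r
  p+q≡r+r = begin
    p + q                      ≡⟨ halves p q ⟩
    ½ * (p + q) + ½ * (p + q)  ≡⟨ cong₂ _+_ mid≡r mid≡r ⟩
    r + r                      ∎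

Between : ℚ → ℚ → ℚ → Set
Between p q r = p < q × q < r ⊎ r < q × q < p

distinct⇒between : ∀ {p q r} → p ≢ q → q ≢ r → p ≢ r →
                   Between q p r ⊎ Between p q r ⊎ Between p r q
distinct⇒between {p} {q} {r} p≢q q≢r p≢r with ℚ.<-cmp p q | ℚ.<-cmp q r | ℚ.<-cmp p r
... | tri≈ _ p≡q _ | _            | _            = contradiction p≡q p≢q
... | _            | tri≈ _ q≡r _ | _            = contradiction q≡r q≢r
... | _            | _            | tri≈ _ p≡r _ = contradiction p≡r p≢r
... | tri< p<q _ _ | tri< q<r _ _ | _            = inj₂ (inj₁ (inj₁ (p<q , q<r)))
... | tri> _ _ q<p | tri> _ _ r<q | _            = inj₂ (inj₁ (inj₂ (r<q , q<p)))
... | tri< _ _ _   | tri> _ _ r<q | tri< p<r _ _ = inj₂ (inj₂ (inj₁ (p<r , r<q)))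
... | tri< p<q _ _ | tri> _ _ _   | tri> _ _ r<p = inj₁ (inj₂ (r<p , p<q))
... | tri> _ _ q<p | tri< _ _ _   | tri< p<r _ _ = inj₁ (inj₁ (q<p , p<r))
... | tri> _ _ _   | tri< q<r _ _ | tri> _ _ r<p = inj₂ (inj₂ (inj₂ (q<r , r<p)))

·-comm : ∀ x y → x · y ≡ y · x
·-comm (x₁ , x₂) (y₁ , y₂) = cong₂ _+_ (ℚ.*-comm x₁ y₁) (ℚ.*-comm x₂ y₂)

·-distribˡ-⊕ : ∀ a x y → a · (x ⊕ y) ≡ a · x + a · y
·-distribˡ-⊕ (a₁ , a₂) (x₁ , x₂) (y₁ , y₂) =
  solve 6 (λ a₁ a₂ x₁ x₂ y₁ y₂ → a₁ :* (x₁ :+ y₁) :+ a₂ :* (x₂ :+ y₂)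
                               := (a₁ :* x₁ :+ a₂ :* x₂) :+ (a₁ :* y₁ :+ a₂ :* y₂))
    refl a₁ a₂ x₁ x₂ y₁ y₂

·-distribˡ-⊖ : ∀ a x y → a · (x ⊖ y) ≡ a · x - a · y
·-distribˡ-⊖ (a₁ , a₂) (x₁ , x₂) (y₁ , y₂) =
  solve 6 (λ a₁ a₂ x₁ x₂ y₁ y₂ → a₁ :* (x₁ :- y₁) :+ a₂ :* (x₂ :- y₂)
                               := (a₁ :* x₁ :+ a₂ :* x₂) :- (a₁ :* y₁ :+ a₂ :* y₂))
    refl a₁ a₂ x₁ x₂ y₁ y₂

·-distribʳ-⊖ : ∀ x y a → (x ⊖ y) · a ≡ x · a - y · a
·-distribʳ-⊖ (x₁ , x₂) (y₁ , y₂) (a₁ , a₂) =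
  solve 6 (λ a₁ a₂ x₁ x₂ y₁ y₂ → (x₁ :- y₁) :* a₁ :+ (x₂ :- y₂) :* a₂
                               := (x₁ :* a₁ :+ x₂ :* a₂) :- (y₁ :* a₁ :+ y₂ :* a₂))
    refl a₁ a₂ x₁ x₂ y₁ y₂

·-⊛ʳ : ∀ a μ x → a · (μ ⊛ x) ≡ μ * (a · x)
·-⊛ʳ (a₁ , a₂) μ (x₁ , x₂) =
  solve 5 (λ a₁ a₂ μ x₁ x₂ → a₁ :* (μ :* x₁) :+ a₂ :* (μ :* x₂) := μ :* (a₁ :* x₁ :+ a₂ :* x₂))
    refl a₁ a₂ μ x₁ x₂

·-⊛ˡ : ∀ μ x a → (μ ⊛ x) · a ≡ μ * (x · a)
·-⊛ˡ μ x a = trans (·-comm (μ ⊛ x) a) (trans (·-⊛ʳ a μ x) (cong (μ *_) (·-comm a x)))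

·-midpoint : ∀ a x y → a · (½ ⊛ (x ⊕ y)) ≡ ½ * (a · x + a · y)
·-midpoint a x y = trans (·-⊛ʳ a ½ (x ⊕ y)) (cong (½ *_) (·-distribˡ-⊕ a x y))

·-line : ∀ a o t m → a · (o ⊕ (t ⊛ m)) ≡ a · o + t * (a · m)
·-line a o t m = trans (·-distribˡ-⊕ a o (t ⊛ m)) (cong (a · o +_) (·-⊛ʳ a t m))

x⊖y≡origin⇒x≡y : ∀ {x y} → x ⊖ y ≡ origin → x ≡ y
x⊖y≡origin⇒x≡y {x₁ , x₂} {y₁ , y₂} eq =
  cong₂ _,_ (x∙y⁻¹≈ε⇒x≈y x₁ y₁ (cong proj₁ eq)) (x∙y⁻¹≈ε⇒x≈y x₂ y₂ (cong proj₂ eq))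

y≡x⊕u⇒y⊖x≡u : ∀ {x y u} → y ≡ x ⊕ u → y ⊖ x ≡ u
y≡x⊕u⇒y⊖x≡u {x₁ , x₂} {u = u₁ , u₂} refl = cong₂ _,_ (cancel x₁ u₁) (cancel x₂ u₂)
  where
  cancel : ∀ x u → x + u - x ≡ u
  cancel = solve 2 (λ x u → x :+ u :- x := u) refl

y⊖x≡u⇒y≡x⊕u : ∀ {x y u} → y ⊖ x ≡ u → y ≡ x ⊕ u
y⊖x≡u⇒y≡x⊕u {x₁ , x₂} {y₁ , y₂} refl = cong₂ _,_ (cancel x₁ y₁) (cancel x₂ y₂)
  where
  cancel : ∀ x y → y ≡ x + (y - x)
  cancel = solve 2 (λ x y → y := x :+ (y :- x)) refl

0⊛x≡origin : ∀ x → 0ℚ ⊛ x ≡ origin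
0⊛x≡origin (x₁ , x₂) = cong₂ _,_ (ℚ.*-zeroˡ x₁) (ℚ.*-zeroˡ x₂)

1⊛x≡x : ∀ x → 1ℚ ⊛ x ≡ x
1⊛x≡x (x₁ , x₂) = cong₂ _,_ (ℚ.*-identityˡ x₁) (ℚ.*-identityˡ x₂)

x⊕0⊛m≡x : ∀ x m → x ⊕ (0ℚ ⊛ m) ≡ x
x⊕0⊛m≡x (x₁ , x₂) m = cong₂ _,_ (zero-step x₁ (proj₁ m)) (zero-step x₂ (proj₂ m))
  where
  zero-step : ∀ x m → x + 0ℚ * m ≡ x
  zero-step = solve 2 (λ x m → x :+ con 0ℚ :* m := x) refl

⊕-⊛-shift : ∀ x m λ′ μ → x ⊕ (μ ⊛ m) ≡ (x ⊕ (λ′ ⊛ m)) ⊕ ((μ - λ′) ⊛ m)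
⊕-⊛-shift (x₁ , x₂) (m₁ , m₂) λ′ μ = cong₂ _,_ (shift x₁ m₁) (shift x₂ m₂)
  where
  shift : ∀ x m → x + μ * m ≡ x + λ′ * m + (μ - λ′) * m
  shift x m = solve 4 (λ x m λ′ μ → x :+ μ :* m := x :+ λ′ :* m :+ (μ :- λ′) :* m) refl x m λ′ μ

midpoint-on-line : ∀ x y m λ′ → y ≡ x ⊕ (λ′ ⊛ m) → ½ ⊛ (x ⊕ y) ≡ x ⊕ ((½ * λ′) ⊛ m)
midpoint-on-line (x₁ , x₂) _ (m₁ , m₂) λ′ refl = cong₂ _,_ (halve x₁ m₁) (halve x₂ m₂)
  where
  halve : ∀ x m → ½ * (x + (x + λ′ * m)) ≡ x + ½ * λ′ * m
  halve x m = solve 3 (λ x m λ′ → con ½ :* (x :+ (x :+ λ′ :* m)) := x :+ con ½ :* λ′ :* m) refl x m λ′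

perp : Point → Point
perp (a₁ , a₂) = (- a₂ , a₁)

det : Point → Point → ℚ
det (a₁ , a₂) (b₁ , b₂) = a₁ * b₂ - a₂ * b₁

perp≢origin : ∀ {a} → a ≢ origin → perp a ≢ origin
perp≢origin {a₁ , a₂} a≢0 eq =
  a≢0 (cong₂ _,_ (cong proj₂ eq) (ℚ.neg-injective (cong proj₁ eq)))

det-antisym : ∀ a b → det a b ≡ - det b a
det-antisym (a₁ , a₂) (b₁ , b₂) =
  solve 4 (λ a₁ a₂ b₁ b₂ → a₁ :* b₂ :- a₂ :* b₁ := :- (b₁ :* a₂ :- b₂ :* a₁)) refl a₁ a₂ b₁ b₂

det-self : ∀ a → det a a ≡ 0ℚ
det-self (a₁ , a₂) = solve 2 (λ a₁ a₂ → a₁ :* a₂ :- a₂ :* a₁ := con 0ℚ) refl a₁ a₂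

det-originˡ : ∀ b → det origin b ≡ 0ℚ
det-originˡ (b₁ , b₂) = solve 2 (λ b₁ b₂ → con 0ℚ :* b₂ :- con 0ℚ :* b₁ := con 0ℚ) refl b₁ b₂

·-perp : ∀ b a → b · perp a ≡ det a b
·-perp (b₁ , b₂) (a₁ , a₂) =
  solve 4 (λ a₁ a₂ b₁ b₂ → b₁ :* (:- a₂) :+ b₂ :* a₁ := a₁ :* b₂ :- a₂ :* b₁) refl a₁ a₂ b₁ b₂

det-perpˡ : ∀ a u → det (perp a) u ≡ - (a · u)
det-perpˡ (a₁ , a₂) (u₁ , u₂) =
  solve 4 (λ a₁ a₂ u₁ u₂ → (:- a₂) :* u₂ :- a₁ :* u₁ := :- (a₁ :* u₁ :+ a₂ :* u₂)) refl a₁ a₂ u₁ u₂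

det≡0∧a₁≢0⇒∥ : ∀ {a₁ a₂ u₁ u₂} → a₁ ≢ 0ℚ → det (a₁ , a₂) (u₁ , u₂) ≡ 0ℚ →
                ∃ λ ρ → (u₁ , u₂) ≡ ρ ⊛ (a₁ , a₂)
det≡0∧a₁≢0⇒∥ {a₁} {a₂} {u₁} {u₂} a₁≢0 det≡0 =
  ρ , cong₂ _,_ (sym (p*recip[q]*q≡p u₁ a₁ a₁≢0)) u₂≡ρ*a₂
  where
  ρ : ℚ
  ρ = u₁ * recip a₁
  u₂≡ρ*a₂ : u₂ ≡ ρ * a₂
  u₂≡ρ*a₂ = begin
    u₂                  ≡⟨ sym (p*recip[q]*q≡p u₂ a₁ a₁≢0) ⟩
    u₂ * recip a₁ * a₁  ≡⟨ solve 3 (λ u r a → u :* r :* a := a :* u :* r) refl u₂ (recip a₁) a₁ ⟩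
    a₁ * u₂ * recip a₁  ≡⟨ cong (_* recip a₁) (x∙y⁻¹≈ε⇒x≈y (a₁ * u₂) (a₂ * u₁) det≡0) ⟩
    a₂ * u₁ * recip a₁  ≡⟨ solve 3 (λ a u r → a :* u :* r := u :* r :* a) refl a₂ u₁ (recip a₁) ⟩
    ρ * a₂              ∎

det-swap : ∀ a u → det (swap a) (swap u) ≡ - det a u
det-swap (a₁ , a₂) (u₁ , u₂) =
  solve 4 (λ a₁ a₂ u₁ u₂ → a₂ :* u₁ :- a₁ :* u₂ := :- (a₁ :* u₂ :- a₂ :* u₁)) refl a₁ a₂ u₁ u₂

det≡0⇒∥ : ∀ a u → a ≢ origin → det a u ≡ 0ℚ → ∃ λ ρ → u ≡ ρ ⊛ a
det≡0⇒∥ a@(a₁ , a₂) u@(u₁ , u₂) a≢0 det≡0 with a₁ ℚ.≟ 0ℚ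
... | no a₁≢0 = det≡0∧a₁≢0⇒∥ a₁≢0 det≡0
... | yes a₁≡0 = Product.map₂ (cong swap) (det≡0∧a₁≢0⇒∥ a₂≢0 (trans (det-swap a u) (cong -_ det≡0)))
  where
  a₂≢0 : a₂ ≢ 0ℚ
  a₂≢0 a₂≡0 = a≢0 (cong₂ _,_ a₁≡0 a₂≡0)

⊥⇒∥perp : ∀ a u → a ≢ origin → a · u ≡ 0ℚ → ∃ λ ρ → u ≡ ρ ⊛ perp a
⊥⇒∥perp a u a≢0 a·u≡0 = det≡0⇒∥ (perp a) u (perp≢origin a≢0) (trans (det-perpˡ a u) (cong -_ a·u≡0))

⊥-transversal⇒≡origin : ∀ a b w → det a b ≢ 0ℚ → a · w ≡ 0ℚ → b · w ≡ 0ℚ → w ≡ origin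
⊥-transversal⇒≡origin a b w det≢0 a·w≡0 b·w≡0 = begin
  w                ≡⟨ w≡ρ⊛a⊥ ⟩
  ρ ⊛ perp a       ≡⟨ cong (_⊛ perp a) ρ≡0 ⟩
  0ℚ ⊛ perp a      ≡⟨ 0⊛x≡origin (perp a) ⟩
  origin           ∎
  where
  a≢0 : a ≢ origin
  a≢0 refl = det≢0 (det-originˡ b)
  ρ : ℚ
  ρ = proj₁ (⊥⇒∥perp a w a≢0 a·w≡0)
  w≡ρ⊛a⊥ : w ≡ ρ ⊛ perp a
  w≡ρ⊛a⊥ = proj₂ (⊥⇒∥perp a w a≢0 a·w≡0)
  ρ*det≡0 : det a b * ρ ≡ 0ℚ
  ρ*det≡0 = begin
    det a b * ρ          ≡⟨ ℚ.*-comm (det a b) ρ ⟩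
    ρ * det a b          ≡⟨ cong (ρ *_) (sym (·-perp b a)) ⟩
    ρ * (b · perp a)     ≡⟨ sym (·-⊛ʳ b ρ (perp a)) ⟩
    b · (ρ ⊛ perp a)     ≡⟨ cong (b ·_) (sym w≡ρ⊛a⊥) ⟩
    b · w                ≡⟨ b·w≡0 ⟩
    0ℚ                   ∎
  ρ≡0 : ρ ≡ 0ℚ
  ρ≡0 = p≢0∧p*q≡0⇒q≡0 det≢0 ρ*det≡0

⊥-common⇒·-zero : ∀ a u w n → a ≢ origin → u ≢ origin →
                  a · u ≡ 0ℚ → a · w ≡ 0ℚ → u · n ≡ 0ℚ → w · n ≡ 0ℚ
⊥-common⇒·-zero a u w n a≢0 u≢0 a·u≡0 a·w≡0 u·n≡0 = begin
  w · n                ≡⟨ cong (_· n) w≡σ⊛a⊥ ⟩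
  (σ ⊛ perp a) · n     ≡⟨ ·-⊛ˡ σ (perp a) n ⟩
  σ * (perp a · n)     ≡⟨ cong (σ *_) a⊥·n≡0 ⟩
  σ * 0ℚ               ≡⟨ ℚ.*-zeroʳ σ ⟩
  0ℚ                   ∎
  where
  ρ σ : ℚ
  ρ = proj₁ (⊥⇒∥perp a u a≢0 a·u≡0)
  σ = proj₁ (⊥⇒∥perp a w a≢0 a·w≡0)
  u≡ρ⊛a⊥ : u ≡ ρ ⊛ perp a
  u≡ρ⊛a⊥ = proj₂ (⊥⇒∥perp a u a≢0 a·u≡0)
  w≡σ⊛a⊥ : w ≡ σ ⊛ perp a
  w≡σ⊛a⊥ = proj₂ (⊥⇒∥perp a w a≢0 a·w≡0)
  ρ≢0 : ρ ≢ 0ℚ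
  ρ≢0 ρ≡0 = u≢0 (trans u≡ρ⊛a⊥ (trans (cong (_⊛ perp a) ρ≡0) (0⊛x≡origin (perp a))))
  a⊥·n≡0 : perp a · n ≡ 0ℚ
  a⊥·n≡0 = p≢0∧p*q≡0⇒q≡0 ρ≢0
    (trans (sym (·-⊛ˡ ρ (perp a) n)) (trans (cong (_· n) (sym u≡ρ⊛a⊥)) u·n≡0))


module _ (B : Polygon) where
  open Polygon B

  LineThroughInterior : Point → Point → Set
  LineThroughInterior o m = ∃ λ μ → Interior B (o ⊕ (μ ⊛ m))

  midpoint-InB : ∀ {x y} → InB B x → InB B y → InB B (½ ⊛ (x ⊕ y))
  midpoint-InB {x} {y} x∈B y∈B s =
    subst (_≤ β s) (sym (·-midpoint (α s) x y)) (½*[p+q]≤r (x∈B s) (y∈B s))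

  tight-midpoint⇒tight : ∀ {x y} s → InB B x → InB B y → α s · (½ ⊛ (x ⊕ y)) ≡ β s →
                         α s · x ≡ β s × α s · y ≡ β s
  tight-midpoint⇒tight {x} {y} s x∈B y∈B mid-tight =
    ½*[p+q]≡r⇒p≡r (x∈B s) (y∈B s) avg≡β ,
    ½*[p+q]≡r⇒p≡r (y∈B s) (x∈B s) (trans (cong (½ *_) (ℚ.+-comm (α s · y) (α s · x))) avg≡β)
    where
    avg≡β : ½ * (α s · x + α s · y) ≡ β s
    avg≡β = trans (sym (·-midpoint (α s) x y)) mid-tight

  tight-midpoint⇒chord-⊥ : ∀ {x y} s → InB B x → InB B y → α s · (½ ⊛ (x ⊕ y)) ≡ β s →
                           α s · (x ⊖ y) ≡ 0ℚ
  tight-midpoint⇒chord-⊥ {x} {y} s x∈B y∈B mid-tight =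
    trans (·-distribˡ-⊖ (α s) x y) (x≈y⇒x∙y⁻¹≈ε (trans x-tight (sym y-tight)))
    where
    x-tight : α s · x ≡ β s
    x-tight = proj₁ (tight-midpoint⇒tight s x∈B y∈B mid-tight)
    y-tight : α s · y ≡ β s
    y-tight = proj₂ (tight-midpoint⇒tight s x∈B y∈B mid-tight)

  transversal-tight⇒Corner : ∀ {x} s t → InB B x → α s · x ≡ β s → α t · x ≡ β t →
                             det (α s) (α t) ≢ 0ℚ → Corner B x
  transversal-tight⇒Corner {x} s t x∈B s-tight t-tight det≢0 = x∈B , extreme
    where
    extreme : ∀ y z → InB B y → InB B z → x ≡ ½ ⊛ (y ⊕ z) → y ≡ z
    extreme y z y∈B z∈B x≡mid = x⊖y≡origin⇒x≡y
      (⊥-transversal⇒≡origin (α s) (α t) (y ⊖ z) det≢0 (chord-⊥ s s-tight) (chord-⊥ t t-tight))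
      where
      chord-⊥ : ∀ u → α u · x ≡ β u → α u · (y ⊖ z) ≡ 0ℚ
      chord-⊥ u u-tight = tight-midpoint⇒chord-⊥ u y∈B z∈B (subst (λ w → α u · w ≡ β u) x≡mid u-tight)

  boundary-not-between-< : ∀ o m {t₁ t₂ t₃} → LineThroughInterior o m →
                         InB B (o ⊕ (t₁ ⊛ m)) → Boundary B (o ⊕ (t₂ ⊛ m)) → InB B (o ⊕ (t₃ ⊛ m)) →
                         t₁ < t₂ → t₂ < t₃ → ⊥
  boundary-not-between-< o m {t₁} {t₂} {t₃} (μ , interior) p₁∈B (_ , s , p₂-tight) p₃∈B
                         t₁<t₂ t₂<t₃ = by-slope (ℚ.<-cmp 0ℚ (α s · m))
    where
    φ : ℚ → ℚ
    φ t = α s · o + t * (α s · m)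

    φ-tight : φ t₂ ≡ β s
    φ-tight = trans (sym (·-line (α s) o t₂ m)) p₂-tight

    exceeds : ∀ t → InB B (o ⊕ (t ⊛ m)) → φ t₂ < φ t → ⊥
    exceeds t p∈B lt = ℚ.<-irrefl refl
      (ℚ.<-≤-trans (subst₂ _<_ φ-tight (sym (·-line (α s) o t m)) lt) (p∈B s))

    by-slope : Tri (0ℚ < α s · m) (0ℚ ≡ α s · m) (α s · m < 0ℚ) → ⊥
    by-slope (tri< 0<slope _ _) = exceeds t₃ p₃∈B
      (ℚ.+-monoʳ-< (α s · o) (ℚ.*-monoˡ-<-pos (α s · m) {{ℚ.positive 0<slope}} t₂<t₃))
    by-slope (tri> _ _ slope<0) = exceeds t₁ p₁∈B
      (ℚ.+-monoʳ-< (α s · o) (ℚ.*-monoˡ-<-neg (α s · m) {{ℚ.negative slope<0}} t₁<t₂))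
    by-slope (tri≈ _ 0≡slope _) = ℚ.<-irrefl center-tight (interior s)
      where
      center-tight : α s · (o ⊕ (μ ⊛ m)) ≡ β s
      center-tight = begin
        α s · (o ⊕ (μ ⊛ m))        ≡⟨ ·-line (α s) o μ m ⟩
        α s · o + μ * (α s · m)    ≡⟨ cong (λ c → α s · o + μ * c) (sym 0≡slope) ⟩
        α s · o + μ * 0ℚ           ≡⟨ cong (α s · o +_) (trans (ℚ.*-zeroʳ μ) (sym (ℚ.*-zeroʳ t₂))) ⟩
        α s · o + t₂ * 0ℚ          ≡⟨ cong (λ c → α s · o + t₂ * c) 0≡slope ⟩
        φ t₂                       ≡⟨ φ-tight ⟩
        β s                        ∎

  boundary-not-between : ∀ o m {t₁ t₂ t₃} → LineThroughInterior o m →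
                         InB B (o ⊕ (t₁ ⊛ m)) → Boundary B (o ⊕ (t₂ ⊛ m)) → InB B (o ⊕ (t₃ ⊛ m)) →
                         Between t₁ t₂ t₃ → ⊥
  boundary-not-between o m meets p₁∈B p₂∈∂B p₃∈B (inj₁ (t₁<t₂ , t₂<t₃)) =
    boundary-not-between-< o m meets p₁∈B p₂∈∂B p₃∈B t₁<t₂ t₂<t₃
  boundary-not-between o m meets p₁∈B p₂∈∂B p₃∈B (inj₂ (t₃<t₂ , t₂<t₁)) =
    boundary-not-between-< o m meets p₃∈B p₂∈∂B p₁∈B t₃<t₂ t₂<t₁

  at-most-two-boundary-points : ∀ o m {t₁ t₂ t₃} → LineThroughInterior o m →
    Boundary B (o ⊕ (t₁ ⊛ m)) → Boundary B (o ⊕ (t₂ ⊛ m)) → Boundary B (o ⊕ (t₃ ⊛ m)) →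
    t₁ ≢ t₂ → t₂ ≢ t₃ → t₁ ≢ t₃ → ⊥
  at-most-two-boundary-points o m meets p₁∈∂B p₂∈∂B p₃∈∂B t₁≢t₂ t₂≢t₃ t₁≢t₃
    with distinct⇒between t₁≢t₂ t₂≢t₃ t₁≢t₃
  ... | inj₁ t₁-between =
    boundary-not-between o m meets (proj₁ p₂∈∂B) p₁∈∂B (proj₁ p₃∈∂B) t₁-between
  ... | inj₂ (inj₁ t₂-between) =
    boundary-not-between o m meets (proj₁ p₁∈∂B) p₂∈∂B (proj₁ p₃∈∂B) t₂-between
  ... | inj₂ (inj₂ t₃-between) =
    boundary-not-between o m meets (proj₁ p₁∈∂B) p₃∈∂B (proj₁ p₂∈∂B) t₃-between

  interior? : ∀ x → Dec (Interior B x)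
  interior? x = Fin.all? λ s → α s · x ℚ.<? β s

  ParallelTightSides : Point → Set
  ParallelTightSides x = ∀ s t → α s · x ≡ β s → α t · x ≡ β t → det (α s) (α t) ≡ 0ℚ

  TransversalTightSides : Point → Set
  TransversalTightSides x = ∃ λ s → ∃ λ t → α s · x ≡ β s × α t · x ≡ β t × det (α s) (α t) ≢ 0ℚ

  transversalTightSides? : ∀ x → Dec (TransversalTightSides x)
  transversalTightSides? x = Fin.any? λ s → Fin.any? λ t →
    α s · x ℚ.≟ β s ×-dec α t · x ℚ.≟ β t ×-dec ¬? (det (α s) (α t) ℚ.≟ 0ℚ)

  ¬transversal⇒parallel : ∀ {x} → ¬ TransversalTightSides x → ParallelTightSides x
  ¬transversal⇒parallel ¬transversal s t s-tight t-tight =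
    decidable-stable (det (α s) (α t) ℚ.≟ 0ℚ) (λ det≢0 → ¬transversal (s , t , s-tight , t-tight , det≢0))

  corner⊎parallel : ∀ {l} (T : Fin l → Point) → (∀ i → InB B (T i)) →
                    (∃ λ i → Corner B (T i)) ⊎ (∀ i → ParallelTightSides (T i))
  corner⊎parallel T T⊆B with Fin.any? (λ i → transversalTightSides? (T i))
  ... | yes (i , s , t , s-tight , t-tight , det≢0) =
    inj₁ (i , transversal-tight⇒Corner s t (T⊆B i) s-tight t-tight det≢0)
  ... | no ¬transversal = inj₂ (λ i → ¬transversal⇒parallel (λ tr → ¬transversal (i , tr)))

  -- The value origin is junk: tangent is only used at boundary points.
  tangent : Point → Point
  tangent x with Fin.any? (λ s → α s · x ℚ.≟ β s)
  ... | yes (s , _) = perp (α s)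
  ... | no _        = origin

  tangent-spec : ∀ {x} → Boundary B x → ∃ λ s → α s · x ≡ β s × tangent x ≡ perp (α s)
  tangent-spec {x} x∈∂B with Fin.any? (λ s → α s · x ℚ.≟ β s)
  ... | yes (s , s-tight) = s , s-tight , refl
  ... | no ¬tight         = contradiction (proj₂ x∈∂B) ¬tight

  tangent≢origin : ∀ {x} → Boundary B x → tangent x ≢ origin
  tangent≢origin x∈∂B with tangent-spec x∈∂B
  ... | s , _ , tangent≡ = λ tangent≡0 → perp≢origin (α≢0 s) (trans (sym tangent≡) tangent≡0)

  tangent-⊥-tight : ∀ {x} t → Boundary B x → ParallelTightSides x → α t · x ≡ β t →
                    α t · tangent x ≡ 0ℚ
  tangent-⊥-tight {x} t x∈∂B parallel t-tight with tangent-spec x∈∂B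
  ... | s , s-tight , tangent≡ = begin
    α t · tangent x      ≡⟨ cong (α t ·_) tangent≡ ⟩
    α t · perp (α s)     ≡⟨ ·-perp (α t) (α s) ⟩
    det (α s) (α t)      ≡⟨ parallel s t s-tight t-tight ⟩
    0ℚ                   ∎

≢-≢⇒≡ : ∀ {x y z : Fin 2} → x ≢ y → y ≢ z → x ≡ z
≢-≢⇒≡ {zero}     {zero}               x≢y _   = contradiction refl x≢y
≢-≢⇒≡ {suc zero} {suc zero}           x≢y _   = contradiction refl x≢y
≢-≢⇒≡ {_}        {zero}     {zero}     _   y≢z = contradiction refl y≢z
≢-≢⇒≡ {_}        {suc zero} {suc zero} _   y≢z = contradiction refl y≢z
≢-≢⇒≡ {zero}     {suc zero} {zero}     _   _   = refl
≢-≢⇒≡ {suc zero} {zero}     {suc zero} _   _   = refl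

-- fromℤ z = z / 1 in normal form, on which ℚ's operations compute.
integer : ℤ → ℚ
integer z = mkℚ z 0 (Coprimality.sym (Coprimality.1-coprimeTo _))

fromℤ≡integer : ∀ z → fromℤ z ≡ integer z
fromℤ≡integer z = ℚ.↥p/↧p≡p (integer z)

fromℤ-injective : ∀ {a b} → fromℤ a ≡ fromℤ b → a ≡ b
fromℤ-injective {a} {b} eq =
  cong ℚ.numerator (trans (sym (fromℤ≡integer a)) (trans eq (fromℤ≡integer b)))

fromℤ-neg : ∀ z → fromℤ (ℤ.- z) ≡ - fromℤ z
fromℤ-neg z = trans (fromℤ≡integer (ℤ.- z)) (trans (integer-neg z) (cong -_ (sym (fromℤ≡integer z))))
  where
  integer-neg : ∀ z → integer (ℤ.- z) ≡ - integer z
  integer-neg (ℤ.+ 0)    = refl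
  integer-neg ℤ.+[1+ n ] = refl
  integer-neg ℤ.-[1+ n ] = refl

fromℤ-* : ∀ a b → fromℤ (a ℤ.* b) ≡ fromℤ a * fromℤ b
fromℤ-* a b rewrite fromℤ≡integer a | fromℤ≡integer b = refl

module _ (P : Rider) where
  open Rider P

  mv≢origin : ∀ r → mv r ≢ origin
  mv≢origin r mv≡0 = contradiction (Coprimality.0-coprimeTo-m⇒m≡1 0-coprime-0) λ ()
    where
    0-coprime-0 : Coprimality.Coprime 0 0
    0-coprime-0 = subst₂ Coprimality.Coprime
      (cong ℤ.∣_∣ (fromℤ-injective {c r} {ℤ.0ℤ} (cong proj₁ mv≡0)))
      (cong ℤ.∣_∣ (fromℤ-injective {d r} {ℤ.0ℤ} (cong proj₂ mv≡0)))
      (coprime r)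

  ·nrm≡det : ∀ u r → u · nrm r ≡ det u (mv r)
  ·nrm≡det (u₁ , u₂) r = cong (u₁ * fromℤ (d r) +_) (begin
    u₂ * fromℤ (ℤ.- c r)   ≡⟨ cong (u₂ *_) (fromℤ-neg (c r)) ⟩
    u₂ * - fromℤ (c r)     ≡⟨ ℚ.neg-distribʳ-* u₂ (fromℤ (c r)) ⟨
    - (u₂ * fromℤ (c r))   ∎)

  det-mv≢0 : ∀ {r r′} → r ≢ r′ → det (mv r) (mv r′) ≢ 0ℚ
  det-mv≢0 {zero}     {zero}     r≢r′ = contradiction refl r≢r′
  det-mv≢0 {suc zero} {suc zero} r≢r′ = contradiction refl r≢r′
  det-mv≢0 {zero}     {suc zero} _    = det-mv₀-mv₁≢0
    where
    det-mv₀-mv₁≢0 : det (mv zero) (mv (suc zero)) ≢ 0ℚ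
    det-mv₀-mv₁≢0 det≡0 = nonparallel (begin
      c zero ℤ.* d (suc zero)  ≡⟨ fromℤ-injective (begin
        fromℤ (c zero ℤ.* d (suc zero))               ≡⟨ fromℤ-* (c zero) (d (suc zero)) ⟩
        fromℤ (c zero) * fromℤ (d (suc zero))         ≡⟨ x∙y⁻¹≈ε⇒x≈y _ _ det≡0 ⟩
        fromℤ (d zero) * fromℤ (c (suc zero))         ≡⟨ fromℤ-* (d zero) (c (suc zero)) ⟨
        fromℤ (d zero ℤ.* c (suc zero))               ∎) ⟩
      d zero ℤ.* c (suc zero)  ≡⟨ ℤ.*-comm (d zero) (c (suc zero)) ⟩
      c (suc zero) ℤ.* d zero  ∎)
  det-mv≢0 {suc zero} {zero}     _    det≡0 =
    det-mv≢0 {zero} {suc zero} (λ ()) (trans (det-antisym (mv zero) (mv (suc zero))) (cong -_ det≡0))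

  -- The attack equation: x and y lie on a common line in direction mv r. A record rather than a
  -- synonym, so that x and y are inferable from its type.
  record Attack (r : Fin 2) (x y : Point) : Set where
    constructor attack
    field equation : (x ⊖ y) · nrm r ≡ 0ℚ

  Attack⇒·nrm≡ : ∀ {r x y} → Attack r x y → x · nrm r ≡ y · nrm r
  Attack⇒·nrm≡ {r} {x} {y} (attack eq) = x∙y⁻¹≈ε⇒x≈y _ _ (trans (sym (·-distribʳ-⊖ x y (nrm r))) eq)

  ·nrm≡⇒Attack : ∀ {r x y} → x · nrm r ≡ y · nrm r → Attack r x y
  ·nrm≡⇒Attack {r} {x} {y} eq = attack (trans (·-distribʳ-⊖ x y (nrm r)) (x≈y⇒x∙y⁻¹≈ε eq))

  Attack-sym : ∀ {r x y} → Attack r x y → Attack r y x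
  Attack-sym att = ·nrm≡⇒Attack (sym (Attack⇒·nrm≡ att))

  Attack-trans : ∀ {r x y z} → Attack r x y → Attack r y z → Attack r x z
  Attack-trans att₁ att₂ = ·nrm≡⇒Attack (trans (Attack⇒·nrm≡ att₁) (Attack⇒·nrm≡ att₂))

  on-line⇒Attack : ∀ {r x y} λ′ → y ≡ x ⊕ (λ′ ⊛ mv r) → Attack r y x
  on-line⇒Attack {r} {x} {y} λ′ y≡ = attack (begin
    (y ⊖ x) · nrm r          ≡⟨ cong (_· nrm r) (y≡x⊕u⇒y⊖x≡u y≡) ⟩
    (λ′ ⊛ mv r) · nrm r      ≡⟨ ·-⊛ˡ λ′ (mv r) (nrm r) ⟩
    λ′ * (mv r · nrm r)      ≡⟨ cong (λ′ *_) (·nrm≡det (mv r) r) ⟩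
    λ′ * det (mv r) (mv r)   ≡⟨ cong (λ′ *_) (det-self (mv r)) ⟩
    λ′ * 0ℚ                  ≡⟨ ℚ.*-zeroʳ λ′ ⟩
    0ℚ                       ∎)

  Attack⇒on-line : ∀ {r x y} → Attack r y x → ∃ λ λ′ → y ≡ x ⊕ (λ′ ⊛ mv r)
  Attack⇒on-line {r} {x} {y} (attack eq) =
    Product.map₂ y⊖x≡u⇒y≡x⊕u (det≡0⇒∥ (mv r) (y ⊖ x) (mv≢origin r) det≡0)
    where
    det≡0 : det (mv r) (y ⊖ x) ≡ 0ℚ
    det≡0 = trans (det-antisym (mv r) (y ⊖ x)) (cong -_ (trans (sym (·nrm≡det (y ⊖ x) r)) eq))

  attack? : ∀ r x y → Dec (Attack r x y)
  attack? r x y = map′ attack Attack.equation ((x ⊖ y) · nrm r ℚ.≟ 0ℚ)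

  Attack-unique-move : ∀ {r r′ x y} → r ≢ r′ → Attack r x y → Attack r′ x y → x ≡ y
  Attack-unique-move {r} {r′} {x} {y} r≢r′ att att′ = x⊖y≡origin⇒x≡y (begin
    x ⊖ y           ≡⟨ x⊖y≡λ′⊛mv ⟩
    λ′ ⊛ mv r       ≡⟨ cong (_⊛ mv r) λ′≡0 ⟩
    0ℚ ⊛ mv r       ≡⟨ 0⊛x≡origin (mv r) ⟩
    origin          ∎)
    where
    λ′ : ℚ
    λ′ = proj₁ (Attack⇒on-line att)
    x⊖y≡λ′⊛mv : x ⊖ y ≡ λ′ ⊛ mv r
    x⊖y≡λ′⊛mv = y≡x⊕u⇒y⊖x≡u (proj₂ (Attack⇒on-line att))
    λ′≡0 : λ′ ≡ 0ℚ
    λ′≡0 = p≢0∧p*q≡0⇒q≡0 (det-mv≢0 r≢r′) (begin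
      det (mv r) (mv r′) * λ′    ≡⟨ ℚ.*-comm _ λ′ ⟩
      λ′ * det (mv r) (mv r′)    ≡⟨ cong (λ′ *_) (·nrm≡det (mv r) r′) ⟨
      λ′ * (mv r · nrm r′)       ≡⟨ ·-⊛ˡ λ′ (mv r) (nrm r′) ⟨
      (λ′ ⊛ mv r) · nrm r′       ≡⟨ cong (_· nrm r′) x⊖y≡λ′⊛mv ⟨
      (x ⊖ y) · nrm r′           ≡⟨ Attack.equation att′ ⟩
      0ℚ                         ∎)

module _ (B : Polygon) (P : Rider) where
  open Polygon B
  open Rider P

  Step⇒Attack : ∀ {r x y} → Step B P r x y → Attack P r y x
  Step⇒Attack ((_ , inj₁ (_ , y≡x)) , y≢x)            = contradiction y≡x y≢x
  Step⇒Attack ((_ , inj₂ (_ , _ , _ , λ′ , y≡)) , _) = on-line⇒Attack P λ′ y≡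

  Step⇒LineMeetsInterior : ∀ {r x y} → Step B P r x y → LineMeetsInterior B P r x
  Step⇒LineMeetsInterior ((_ , inj₁ (_ , y≡x)) , y≢x)        = contradiction y≡x y≢x
  Step⇒LineMeetsInterior ((_ , inj₂ (meets , _)) , _)         = meets

  LineMeetsInterior-resp-Attack : ∀ {r x y} → Attack P r y x →
                                  LineMeetsInterior B P r x → LineMeetsInterior B P r y
  LineMeetsInterior-resp-Attack {r} {x} {y} att (μ , interior) =
    μ - λ′ , subst (Interior B)
      (trans (⊕-⊛-shift x (mv r) λ′ μ) (cong (_⊕ ((μ - λ′) ⊛ mv r)) (sym y≡))) interior
    where
    λ′ : ℚ
    λ′ = proj₁ (Attack⇒on-line P att)
    y≡ : y ≡ x ⊕ (λ′ ⊛ mv r)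
    y≡ = proj₂ (Attack⇒on-line P att)

  LineMeetsInterior∧tight⇒transversal : ∀ {r x} s → LineMeetsInterior B P r x → α s · x ≡ β s →
                                        α s · mv r ≢ 0ℚ
  LineMeetsInterior∧tight⇒transversal {r} {x} s (μ , interior) tight slope≡0 =
    ℚ.<-irrefl center-tight (interior s)
    where
    center-tight : α s · (x ⊕ (μ ⊛ mv r)) ≡ β s
    center-tight = begin
      α s · (x ⊕ (μ ⊛ mv r))       ≡⟨ ·-line (α s) x μ (mv r) ⟩
      α s · x + μ * (α s · mv r)   ≡⟨ cong₂ (λ a b → a + μ * b) tight slope≡0 ⟩
      β s + μ * 0ℚ                 ≡⟨ cong (β s +_) (ℚ.*-zeroʳ μ) ⟩
      β s + 0ℚ                     ≡⟨ ℚ.+-identityʳ (β s) ⟩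
      β s                          ∎

  at-most-two-antipodes : ∀ {r x y z} → LineMeetsInterior B P r x →
    Boundary B x → Boundary B y → Boundary B z → Attack P r y x → Attack P r z x →
    x ≢ y → x ≢ z → y ≢ z → ⊥
  at-most-two-antipodes {r} {x} {y} {z} meets x∈∂B y∈∂B z∈∂B y-att z-att x≢y x≢z y≢z =
    at-most-two-boundary-points B x (mv r) {0ℚ} {λ′} {ρ} meets
      (subst (Boundary B) (sym (x⊕0⊛m≡x x (mv r))) x∈∂B)
      (subst (Boundary B) y≡ y∈∂B) (subst (Boundary B) z≡ z∈∂B)
      (λ 0≡λ′ → x≢y (sym (trans y≡ (point-at 0≡λ′))))
      (λ λ′≡ρ → y≢z (trans y≡ (trans (cong (λ t → x ⊕ (t ⊛ mv r)) λ′≡ρ) (sym z≡))))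
      (λ 0≡ρ → x≢z (sym (trans z≡ (point-at 0≡ρ))))
    where
    λ′ ρ : ℚ
    λ′ = proj₁ (Attack⇒on-line P y-att)
    ρ = proj₁ (Attack⇒on-line P z-att)
    y≡ : y ≡ x ⊕ (λ′ ⊛ mv r)
    y≡ = proj₂ (Attack⇒on-line P y-att)
    z≡ : z ≡ x ⊕ (ρ ⊛ mv r)
    z≡ = proj₂ (Attack⇒on-line P z-att)
    point-at : ∀ {t} → 0ℚ ≡ t → x ⊕ (t ⊛ mv r) ≡ x
    point-at 0≡t = trans (cong (λ t → x ⊕ (t ⊛ mv r)) (sym 0≡t)) (x⊕0⊛m≡x x (mv r))

  tangent·nrm≢0 : ∀ {r x} → Boundary B x → LineMeetsInterior B P r x → tangent B x · nrm r ≢ 0ℚ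
  tangent·nrm≢0 {r} {x} x∈∂B meets with tangent-spec B x∈∂B
  ... | s , s-tight , tangent≡ = λ eq →
    LineMeetsInterior∧tight⇒transversal s meets s-tight (ℚ.neg-injective (begin
      - (α s · mv r)              ≡⟨ det-perpˡ (α s) (mv r) ⟨
      det (perp (α s)) (mv r)     ≡⟨ ·nrm≡det P (perp (α s)) r ⟨
      perp (α s) · nrm r          ≡⟨ cong (_· nrm r) tangent≡ ⟨
      tangent B x · nrm r         ≡⟨ eq ⟩
      0ℚ                          ∎))

module CyclicIndex (b : ℕ) where

  next : ℕ → ℕ
  next a with a ℕ.<? b
  ... | yes _ = suc a
  ... | no _  = 0

  prev : ℕ → ℕ
  prev zero    = b
  prev (suc a) = a

  -- cyc z is z modulo suc b.
  cyc : ℤ → ℕ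
  cyc (ℤ.+ n)    = fold 0 next n
  cyc ℤ.-[1+ n ] = fold b prev n

  next-< : ∀ {a} → a ℕ.< b → next a ≡ suc a
  next-< {a} a<b with a ℕ.<? b
  ... | yes _  = refl
  ... | no a≮b = contradiction a<b a≮b

  next-last : next b ≡ 0
  next-last with b ℕ.<? b
  ... | yes b<b = contradiction b<b (ℕ.<-irrefl refl)
  ... | no _    = refl

  next-≤ : ∀ a → next a ℕ.≤ b
  next-≤ a with a ℕ.<? b
  ... | yes a<b = a<b
  ... | no _    = z≤n

  prev-≤ : ∀ {a} → a ℕ.≤ b → prev a ℕ.≤ b
  prev-≤ {zero}  _     = ℕ.≤-refl
  prev-≤ {suc a} a+1≤b = ℕ.<⇒≤ a+1≤b

  next-prev : ∀ {a} → a ℕ.≤ b → next (prev a) ≡ a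
  next-prev {zero}  _     = next-last
  next-prev {suc a} a+1≤b = next-< a+1≤b

  cyc-≤ : ∀ z → cyc z ℕ.≤ b
  cyc-≤ (ℤ.+ 0)           = z≤n
  cyc-≤ ℤ.+[1+ n ]       = next-≤ (cyc (ℤ.+ n))
  cyc-≤ ℤ.-[1+ zero ]     = ℕ.≤-refl
  cyc-≤ ℤ.-[1+ suc n ]    = prev-≤ (cyc-≤ ℤ.-[1+ n ])

  cyc-suc : ∀ z → cyc (z ℤ.+ ℤ.1ℤ) ≡ next (cyc z)
  cyc-suc (ℤ.+ n)           = cong (fold 0 next) (ℕ.+-comm n 1)
  cyc-suc ℤ.-[1+ zero ]     = sym next-last
  cyc-suc ℤ.-[1+ suc n ]    = sym (next-prev (cyc-≤ ℤ.-[1+ n ]))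

  cyc-+ : ∀ z m → cyc (z ℤ.+ ℤ.+ m) ≡ fold (cyc z) next m
  cyc-+ z zero    = cong cyc (ℤ.+-identityʳ z)
  cyc-+ z (suc m) = begin
    cyc (z ℤ.+ ℤ.+ suc m)          ≡⟨ cong (λ k → cyc (z ℤ.+ ℤ.+ k)) (ℕ.+-comm 1 m) ⟩
    cyc (z ℤ.+ (ℤ.+ m ℤ.+ ℤ.1ℤ))   ≡⟨ cong cyc (ℤ.+-assoc z (ℤ.+ m) ℤ.1ℤ) ⟨
    cyc ((z ℤ.+ ℤ.+ m) ℤ.+ ℤ.1ℤ)   ≡⟨ cyc-suc (z ℤ.+ ℤ.+ m) ⟩
    next (cyc (z ℤ.+ ℤ.+ m))       ≡⟨ cong next (cyc-+ z m) ⟩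
    fold (cyc z) next (suc m)      ∎

  fold-next : ∀ a m → a ℕ.+ m ℕ.≤ b → fold a next m ≡ a ℕ.+ m
  fold-next a zero    _         = sym (ℕ.+-identityʳ a)
  fold-next a (suc m) a+m+1≤b   = begin
    next (fold a next m)    ≡⟨ cong next (fold-next a m (ℕ.<⇒≤ a+m<b)) ⟩
    next (a ℕ.+ m)          ≡⟨ next-< a+m<b ⟩
    suc (a ℕ.+ m)           ≡⟨ ℕ.+-suc a m ⟨
    a ℕ.+ suc m             ∎
    where
    a+m<b : a ℕ.+ m ℕ.< b
    a+m<b = subst (ℕ._≤ b) (ℕ.+-suc a m) a+m+1≤b

  fold-next-period : ∀ {a} → a ℕ.≤ b → fold a next (suc b) ≡ a
  fold-next-period {a} a≤b = begin
    fold a next (suc b)                    ≡⟨ cong (fold a next) suc[b]≡a+suc[j] ⟩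
    fold a next (a ℕ.+ suc j)              ≡⟨ fold-+ a next a ⟩
    fold (next (fold a next j)) next a     ≡⟨ cong (λ c → fold (next c) next a) (fold-next a j a+j≤b) ⟩
    fold (next (a ℕ.+ j)) next a           ≡⟨ cong (λ c → fold (next c) next a) a+j≡b ⟩
    fold (next b) next a                   ≡⟨ cong (λ c → fold c next a) next-last ⟩
    fold 0 next a                          ≡⟨ fold-next 0 a a≤b ⟩
    a                                      ∎
    where
    j : ℕ
    j = b ℕ.∸ a
    a+j≡b : a ℕ.+ j ≡ b
    a+j≡b = ℕ.m+[n∸m]≡n a≤b
    a+j≤b : a ℕ.+ j ℕ.≤ b
    a+j≤b = ℕ.≤-reflexive a+j≡b
    suc[b]≡a+suc[j] : suc b ≡ a ℕ.+ suc j
    suc[b]≡a+suc[j] = trans (cong suc (sym a+j≡b)) (sym (ℕ.+-suc a j))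

  cyc-periodic : ∀ z → cyc (z ℤ.+ ℤ.+ suc b) ≡ cyc z
  cyc-periodic z = trans (cyc-+ z (suc b)) (fold-next-period (cyc-≤ z))

  cyc[+a]≡a : ∀ {a} → a ℕ.≤ b → cyc (ℤ.+ a) ≡ a
  cyc[+a]≡a {a} a≤b = fold-next 0 a a≤b

module _ (B : Polygon) (P : Rider) {b : ℕ} where
  open CyclicIndex b

  closed-walk⇒IsCyclical : (Q : ℕ → Point) (R : ℕ → Fin 2) → 1 ℕ.≤ b →
    (∀ {a} → a ℕ.≤ b → Step B P (R a) (Q a) (Q (next a))) →
    (∀ {a} → a ℕ.≤ b → R (next a) ≢ R a) →
    (∀ {a a′} → a ℕ.≤ b → a′ ℕ.≤ b → Q a ≡ Q a′ → a ≡ a′) →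
    (T : Fin (suc b) → Point) → (∀ i → Q (toℕ i) ≡ T i) → IsCyclical B P (suc b) T
  closed-walk⇒IsCyclical Q R 1≤b step alternating Q-injective T Q≡T =
    s≤s 1≤b , E , refl , refl , (s≤s z≤n , period , minimal) , ℤ.0ℤ , λ i →
      trans (cong Q (cyc[+a]≡a (ℕ.≤-pred (Fin.toℕ<n i)))) (Q≡T i)
    where
    E : ExtendedTrajectory B P
    E = record
      { lo          = nothing
      ; hi          = nothing
      ; pt          = λ z → Q (cyc z)
      ; rr          = λ z → R (cyc z)
      ; nonempty    = ℤ.0ℤ , _
      ; onBoundary  = λ z _ → proj₁ (proj₁ (step (cyc-≤ z)))
      ; step        = λ z _ _ → subst (λ a → Step B P (R (cyc z)) (Q (cyc z)) (Q a))
                                      (sym (cyc-suc z)) (step (cyc-≤ z))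
      ; alternating = λ z _ _ _ → subst (λ a → R a ≢ R (cyc z)) (sym (cyc-suc z))
                                      (alternating (cyc-≤ z))
      ; maxHi       = λ _ ()
      ; maxLo       = λ _ ()
      }

    period : HasPeriod B P E (suc b)
    period z = cong Q (cyc-periodic z)

    minimal : ∀ q → 1 ℕ.≤ q → q ℕ.< suc b → ¬ HasPeriod B P E q
    minimal q 1≤q q<l q-period = ℕ.<⇒≢ 1≤q (sym (Q-injective (ℕ.≤-pred q<l) z≤n
      (trans (cong Q (sym (cyc[+a]≡a (ℕ.≤-pred q<l)))) (q-period ℤ.0ℤ))))

module Trajectory (B : Polygon) (P : Rider) {b : ℕ} {T : Fin (suc b) → Point}
  (T-injective : Injective _≡_ _≡_ T) (E : ExtendedTrajectory B P) (k : ℤ)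
  (T⊆E : ∀ i → ExtendedTrajectory.InI E (k ℤ.+ ℤ.+ toℕ i) ×
               ExtendedTrajectory.pt E (k ℤ.+ ℤ.+ toℕ i) ≡ T i)
  where
  open Polygon B
  open Rider P
  module E = ExtendedTrajectory E

  Q : ℕ → Point
  Q a = E.pt (k ℤ.+ ℤ.+ a)

  R : ℕ → Fin 2
  R a = E.rr (k ℤ.+ ℤ.+ a)

  T≡Q∘toℕ : ∀ i → T i ≡ Q (toℕ i)
  T≡Q∘toℕ i = sym (proj₂ (T⊆E i))

  toℕ≤b : ∀ (i : Fin (suc b)) → toℕ i ℕ.≤ b
  toℕ≤b i = ℕ.≤-pred (Fin.toℕ<n i)

  index : ∀ {a} → a ℕ.≤ b → Fin (suc b)
  index a≤b = fromℕ< (s≤s a≤b)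

  Q≡T∘index : ∀ {a} (a≤b : a ℕ.≤ b) → Q a ≡ T (index a≤b)
  Q≡T∘index {a} a≤b =
    subst (λ c → Q c ≡ T (index a≤b)) (Fin.toℕ-fromℕ< (s≤s a≤b)) (proj₂ (T⊆E (index a≤b)))

  InI : ∀ {a} → a ℕ.≤ b → E.InI (k ℤ.+ ℤ.+ a)
  InI a≤b = subst (λ c → E.InI (k ℤ.+ ℤ.+ c)) (Fin.toℕ-fromℕ< (s≤s a≤b)) (proj₁ (T⊆E (index a≤b)))

  Q-injective : ∀ {a a′} → a ℕ.≤ b → a′ ℕ.≤ b → Q a ≡ Q a′ → a ≡ a′
  Q-injective {a} {a′} a≤b a′≤b Qa≡Qa′ = begin
    a                  ≡⟨ Fin.toℕ-fromℕ< (s≤s a≤b) ⟨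
    toℕ (index a≤b)    ≡⟨ cong toℕ (T-injective Ta≡Ta′) ⟩
    toℕ (index a′≤b)   ≡⟨ Fin.toℕ-fromℕ< (s≤s a′≤b) ⟩
    a′                 ∎
    where
    Ta≡Ta′ : T (index a≤b) ≡ T (index a′≤b)
    Ta≡Ta′ = trans (sym (Q≡T∘index a≤b)) (trans Qa≡Qa′ (Q≡T∘index a′≤b))

  Q-≢ : ∀ {a a′} → a ℕ.≤ b → a′ ℕ.≤ b → a ≢ a′ → Q a ≢ Q a′
  Q-≢ a≤b a′≤b a≢a′ = a≢a′ ∘ Q-injective a≤b a′≤b

  Q-boundary : ∀ {a} → a ℕ.≤ b → Boundary B (Q a)
  Q-boundary a≤b = E.onBoundary _ (InI a≤b)

  k+[m+a]≡k+a+m : ∀ m a → k ℤ.+ ℤ.+ (m ℕ.+ a) ≡ (k ℤ.+ ℤ.+ a) ℤ.+ ℤ.+ m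
  k+[m+a]≡k+a+m m a = trans (cong (λ c → k ℤ.+ ℤ.+ c) (ℕ.+-comm m a)) (sym (ℤ.+-assoc k (ℤ.+ a) (ℤ.+ m)))

  Q-step : ∀ {a} → a ℕ.< b → Step B P (R a) (Q a) (Q (suc a))
  Q-step {a} a<b = subst (λ z → Step B P (R a) (Q a) (E.pt z)) (sym (k+[m+a]≡k+a+m 1 a))
    (E.step _ (InI (ℕ.<⇒≤ a<b)) (subst E.InI (k+[m+a]≡k+a+m 1 a) (InI a<b)))

  R-alternates : ∀ {a} → suc a ℕ.< b → R (suc a) ≢ R a
  R-alternates {a} a+1<b = subst (λ z → E.rr z ≢ R a) (sym (k+[m+a]≡k+a+m 1 a))
    (E.alternating _ (InI (ℕ.<⇒≤ (ℕ.<-trans (ℕ.n<1+n a) a+1<b)))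
      (subst E.InI (k+[m+a]≡k+a+m 1 a) (InI (ℕ.<⇒≤ a+1<b)))
      (subst E.InI (k+[m+a]≡k+a+m 2 a) (InI a+1<b)))

  step-line-has-no-third-point : ∀ {a e} → a ℕ.< b → e ℕ.≤ b → e ≢ a → e ≢ suc a →
                                 ¬ Attack P (R a) (Q e) (Q a)
  step-line-has-no-third-point {a} {e} a<b e≤b e≢a e≢a+1 att =
    at-most-two-antipodes B P (Step⇒LineMeetsInterior B P (Q-step a<b))
      (Q-boundary a≤b) (Q-boundary a<b) (Q-boundary e≤b) (Step⇒Attack B P (Q-step a<b)) att
      (Q-≢ a≤b a<b (ℕ.<⇒≢ (ℕ.n<1+n a))) (Q-≢ a≤b e≤b (e≢a ∘ sym)) (Q-≢ a<b e≤b (e≢a+1 ∘ sym))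
    where
    a≤b : a ℕ.≤ b
    a≤b = ℕ.<⇒≤ a<b

  inner-point-attacks-only-neighbours : ∀ {a e r} → suc a ℕ.< b → e ℕ.≤ b →
    e ≢ a → e ≢ suc a → e ≢ suc (suc a) → ¬ Attack P r (Q e) (Q (suc a))
  inner-point-attacks-only-neighbours {a} {e} {r} a+1<b e≤b e≢a e≢a+1 e≢a+2 att
    with r Fin.≟ R (suc a)
  ... | yes refl = step-line-has-no-third-point a+1<b e≤b e≢a+1 e≢a+2 att
  ... | no r≢   = step-line-has-no-third-point (ℕ.<-trans (ℕ.n<1+n a) a+1<b) e≤b e≢a e≢a+1
    (Attack-trans P (subst (λ r → Attack P r (Q e) (Q (suc a))) r≡R[a] att)
                    (Step⇒Attack B P (Q-step (ℕ.<-trans (ℕ.n<1+n a) a+1<b))))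
    where
    r≡R[a] : r ≡ R a
    r≡R[a] = ≢-≢⇒≡ r≢ (R-alternates a+1<b)

  adjacent-attack⇒step-move : ∀ {a r} → a ℕ.< b → Attack P r (Q (suc a)) (Q a) → r ≡ R a
  adjacent-attack⇒step-move {a} {r} a<b att = decidable-stable (r Fin.≟ R a) λ r≢R[a] →
    Q-≢ a<b (ℕ.<⇒≤ a<b) (ℕ.<⇒≢ (ℕ.n<1+n a) ∘ sym)
      (Attack-unique-move P r≢R[a] att (Step⇒Attack B P (Q-step a<b)))

  ClosingAttack : Fin 2 → Set
  ClosingAttack r = 2 ℕ.≤ b × r ≢ R 0 × Attack P r (Q b) (Q 0)

  distant-attack⇒closing : ∀ {a a′ r} → suc a ℕ.< a′ → a′ ℕ.≤ b → Attack P r (Q a′) (Q a) →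
                           a ≡ 0 × a′ ≡ b × ClosingAttack r
  distant-attack⇒closing {suc a} {a′} a+2<a′ a′≤b att = ⊥-elim
    (inner-point-attacks-only-neighbours (ℕ.<-≤-trans (ℕ.<-trans (ℕ.n<1+n (suc a)) a+2<a′) a′≤b) a′≤b
      (ℕ.>⇒≢ (ℕ.<-trans (ℕ.<-trans (ℕ.n<1+n a) (ℕ.n<1+n (suc a))) a+2<a′))
      (ℕ.>⇒≢ (ℕ.<-trans (ℕ.n<1+n (suc a)) a+2<a′))
      (ℕ.>⇒≢ a+2<a′) att)
  distant-attack⇒closing {zero} {suc (suc c)} {r} (s≤s (s≤s z≤n)) a′≤b att with ℕ.m≤n⇒m<n∨m≡n a′≤b
  ... | inj₁ a′<b = ⊥-elim
    (inner-point-attacks-only-neighbours a′<b z≤n (λ ()) (λ ()) (λ ()) (Attack-sym P att))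
  ... | inj₂ a′≡b = refl , a′≡b , subst (2 ℕ.≤_) a′≡b (s≤s (s≤s z≤n)) , r≢R[0] ,
                    subst (λ a′ → Attack P r (Q a′) (Q 0)) a′≡b att
    where
    r≢R[0] : r ≢ R 0
    r≢R[0] refl = step-line-has-no-third-point (ℕ.<-≤-trans (s≤s z≤n) a′≤b) a′≤b (λ ()) (λ ()) att

  attack-classification : ∀ {a a′ r} → a ℕ.< a′ → a′ ℕ.≤ b → Attack P r (Q a′) (Q a) →
    a′ ≡ suc a × r ≡ R a ⊎ a ≡ 0 × a′ ≡ b × ClosingAttack r
  attack-classification a<a′ a′≤b att with ℕ.m≤n⇒m<n∨m≡n a<a′
  ... | inj₂ refl    = inj₁ (refl , adjacent-attack⇒step-move a′≤b att)
  ... | inj₁ a+1<a′ = inj₂ (distant-attack⇒closing a+1<a′ a′≤b att)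

  -- Transport the tangent direction at Q 0 along the steps: V (suc a) is the multiple of the
  -- tangent at Q (suc a) satisfying the attack equation of step a.
  V : ℕ → Point
  V zero    = tangent B (Q 0)
  V (suc a) = ((V a · nrm (R a)) * recip (tangent B (Q (suc a)) · nrm (R a))) ⊛ tangent B (Q (suc a))

  V∥tangent : ∀ a → ∃ λ κ → V a ≡ κ ⊛ tangent B (Q a)
  V∥tangent zero    = 1ℚ , sym (1⊛x≡x (tangent B (Q 0)))
  V∥tangent (suc a) = V a · nrm (R a) * recip (tangent B (Q (suc a)) · nrm (R a)) , refl

  V-step : ∀ {a} → a ℕ.< b → Attack P (R a) (V (suc a)) (V a)
  V-step {a} a<b = ·nrm≡⇒Attack P (begin
    V (suc a) · ν                      ≡⟨ ·-⊛ˡ (V a · ν * recip (t · ν)) t ν ⟩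
    V a · ν * recip (t · ν) * (t · ν)  ≡⟨ p*recip[q]*q≡p (V a · ν) (t · ν) t·ν≢0 ⟩
    V a · ν                            ∎)
    where
    ν t : Point
    ν = nrm (R a)
    t = tangent B (Q (suc a))
    t·ν≢0 : t · ν ≢ 0ℚ
    t·ν≢0 = tangent·nrm≢0 B P (Q-boundary a<b)
      (LineMeetsInterior-resp-Attack B P (Step⇒Attack B P (Q-step a<b))
        (Step⇒LineMeetsInterior B P (Q-step a<b)))

  V-fixation : ∀ {a} s → a ℕ.≤ b → ParallelTightSides B (Q a) → α s · Q a ≡ β s → α s · V a ≡ 0ℚ
  V-fixation {a} s a≤b parallel s-tight = begin
    α s · V a                   ≡⟨ cong (α s ·_) (proj₂ (V∥tangent a)) ⟩
    α s · (κ ⊛ tangent B (Q a)) ≡⟨ ·-⊛ʳ (α s) κ (tangent B (Q a)) ⟩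
    κ * (α s · tangent B (Q a)) ≡⟨ cong (κ *_) (tangent-⊥-tight B s (Q-boundary a≤b) parallel s-tight) ⟩
    κ * 0ℚ                      ≡⟨ ℚ.*-zeroʳ κ ⟩
    0ℚ                          ∎
    where
    κ : ℚ
    κ = proj₁ (V∥tangent a)

  VSolvesClosing : Set
  VSolvesClosing = ∀ {r} → ClosingAttack r → Attack P r (V b) (V 0)

  V-resp-Attack-< : ∀ {a a′ r} → VSolvesClosing →
    a ℕ.< a′ → a′ ℕ.≤ b → Attack P r (Q a′) (Q a) → Attack P r (V a′) (V a)
  V-resp-Attack-< {a} {r = r} closing a<a′ a′≤b att with attack-classification a<a′ a′≤b att
  ... | inj₁ (refl , refl)          = V-step (ℕ.<-≤-trans (ℕ.n<1+n a) a′≤b)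
  ... | inj₂ (refl , a′≡b , closes) = subst (λ a′ → Attack P r (V a′) (V 0)) (sym a′≡b) (closing closes)

  V-resp-Attack : ∀ {a a′ r} → VSolvesClosing →
    a ℕ.≤ b → a′ ℕ.≤ b → a ≢ a′ → Attack P r (Q a) (Q a′) → Attack P r (V a) (V a′)
  V-resp-Attack {a} {a′} closing a≤b a′≤b a≢a′ att with ℕ.<-cmp a a′
  ... | tri< a<a′ _ _ = Attack-sym P (V-resp-Attack-< closing a<a′ a′≤b (Attack-sym P att))
  ... | tri≈ _ a≡a′ _ = contradiction a≡a′ a≢a′
  ... | tri> _ _ a′<a = V-resp-Attack-< closing a′<a a≤b att

  V-solvesH : (∀ i → ParallelTightSides B (T i)) → VSolvesClosing → SolvesH B P (suc b) T (V ∘ toℕ)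
  V-solvesH parallel closing = attacks , fixations
    where
    attacks : ∀ i j r → i ≢ j → (T i ⊖ T j) · nrm r ≡ 0ℚ → (V (toℕ i) ⊖ V (toℕ j)) · nrm r ≡ 0ℚ
    attacks i j r i≢j eq = Attack.equation (V-resp-Attack closing (toℕ≤b i) (toℕ≤b j)
      (i≢j ∘ Fin.toℕ-injective)
      (attack (subst₂ (λ x y → (x ⊖ y) · nrm r ≡ 0ℚ) (T≡Q∘toℕ i) (T≡Q∘toℕ j) eq)))
    fixations : ∀ i s → α s · T i ≡ β s → α s · V (toℕ i) ≡ 0ℚ
    fixations i s tight = V-fixation s (toℕ≤b i) (subst (ParallelTightSides B) (T≡Q∘toℕ i) (parallel i))
      (subst (λ x → α s · x ≡ β s) (T≡Q∘toℕ i) tight)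

  chord-midpoint : Point
  chord-midpoint = ½ ⊛ (Q b ⊕ Q 0)

  ClosesThroughInterior : Set
  ClosesThroughInterior = ∃ λ r → ClosingAttack r × Interior B chord-midpoint

  closesThroughInterior? : Dec ClosesThroughInterior
  closesThroughInterior? = Fin.any? λ r →
    (2 ℕ.≤? b ×-dec ¬? (r Fin.≟ R 0) ×-dec attack? P r (Q b) (Q 0)) ×-dec interior? B chord-midpoint

  2≤b⇒b≢0 : 2 ℕ.≤ b → b ≢ 0
  2≤b⇒b≢0 2≤b = ℕ.>⇒≢ (ℕ.≤-trans (s≤s z≤n) 2≤b)

  -- The chord from Q b to Q 0 lies on a side s; by the fixation equations V b ⊖ V 0 is parallel
  -- to s as well, hence to the chord, so it inherits the chord's attack equation.
  closing-through-boundary : (∀ i → ParallelTightSides B (T i)) → ∀ {r} → ClosingAttack r →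
    ¬ Interior B chord-midpoint → Attack P r (V b) (V 0)
  closing-through-boundary parallel {r} (2≤b , _ , att) ¬interior = attack
    (⊥-common⇒·-zero (α s) (Q b ⊖ Q 0) (V b ⊖ V 0) (nrm r) (α≢0 s) Q-chord≢origin
      Q-chord-⊥ V-chord-⊥ (Attack.equation att))
    where
    Qb∈B : InB B (Q b)
    Qb∈B = proj₁ (Q-boundary ℕ.≤-refl)
    Q0∈B : InB B (Q 0)
    Q0∈B = proj₁ (Q-boundary z≤n)
    violated : ∃ λ s → ¬ α s · chord-midpoint < β s
    violated = Fin.¬∀⟶∃¬ n _ (λ s → α s · chord-midpoint ℚ.<? β s) ¬interior
    s : Fin n
    s = proj₁ violated
    midpoint-tight : α s · chord-midpoint ≡ β s
    midpoint-tight = ℚ.≤-antisym (midpoint-InB B Qb∈B Q0∈B s) (ℚ.≮⇒≥ (proj₂ violated))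
    Q-chord-⊥ : α s · (Q b ⊖ Q 0) ≡ 0ℚ
    Q-chord-⊥ = tight-midpoint⇒chord-⊥ B s Qb∈B Q0∈B midpoint-tight
    V-fixation-at : ∀ {a} → a ℕ.≤ b → α s · Q a ≡ β s → α s · V a ≡ 0ℚ
    V-fixation-at a≤b = V-fixation s a≤b
      (subst (ParallelTightSides B) (sym (Q≡T∘index a≤b)) (parallel (index a≤b)))
    V-chord-⊥ : α s · (V b ⊖ V 0) ≡ 0ℚ
    V-chord-⊥ = trans (·-distribˡ-⊖ (α s) (V b) (V 0)) (cong₂ _-_
      (V-fixation-at ℕ.≤-refl (proj₁ (tight-midpoint⇒tight B s Qb∈B Q0∈B midpoint-tight)))
      (V-fixation-at z≤n (proj₂ (tight-midpoint⇒tight B s Qb∈B Q0∈B midpoint-tight))))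
    Q-chord≢origin : Q b ⊖ Q 0 ≢ origin
    Q-chord≢origin = Q-≢ ℕ.≤-refl z≤n (2≤b⇒b≢0 2≤b) ∘ x⊖y≡origin⇒x≡y

  full-rank⇒closesThroughInterior : (∀ i → ParallelTightSides B (T i)) → FullRank B P (suc b) T →
                                    ClosesThroughInterior
  full-rank⇒closesThroughInterior parallel full = decidable-stable closesThroughInterior? λ ¬closes →
    tangent≢origin B (Q-boundary z≤n) (full (V ∘ toℕ) (V-solvesH parallel (closing ¬closes)) zero)
    where
    closing : ¬ ClosesThroughInterior → VSolvesClosing
    closing ¬closes {r} closes = closing-through-boundary parallel closes
      (λ interior → ¬closes (r , closes , interior))

  module Closed (r : Fin 2) (closing : ClosingAttack r) (interior : Interior B chord-midpoint) where
    open CyclicIndex b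

    2≤b : 2 ℕ.≤ b
    2≤b = proj₁ closing

    r≢R[0] : r ≢ R 0
    r≢R[0] = proj₁ (proj₂ closing)

    Q0-on-line : ∃ λ λ′ → Q 0 ≡ Q b ⊕ (λ′ ⊛ mv r)
    Q0-on-line = Attack⇒on-line P (Attack-sym P (proj₂ (proj₂ closing)))

    Q0≢Qb : Q 0 ≢ Q b
    Q0≢Qb = Q-≢ z≤n ℕ.≤-refl (2≤b⇒b≢0 2≤b ∘ sym)

    closing-step : Step B P r (Q b) (Q 0)
    closing-step = (Q-boundary ℕ.≤-refl , inj₂ (meets , Q-boundary z≤n , Q0≢Qb , Q0-on-line)) , Q0≢Qb
      where
      meets : LineMeetsInterior B P r (Q b)
      meets = ½ * proj₁ Q0-on-line , subst (Interior B)
        (midpoint-on-line (Q b) (Q 0) (mv r) (proj₁ Q0-on-line) (proj₂ Q0-on-line)) interior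

    R′ : ℕ → Fin 2
    R′ a with a ℕ.<? b
    ... | yes _ = R a
    ... | no _  = r

    R′-< : ∀ {a} → a ℕ.< b → R′ a ≡ R a
    R′-< {a} a<b with a ℕ.<? b
    ... | yes _  = refl
    ... | no a≮b = contradiction a<b a≮b

    R′-last : R′ b ≡ r
    R′-last with b ℕ.<? b
    ... | yes b<b = contradiction b<b (ℕ.<-irrefl refl)
    ... | no _    = refl

    step : ∀ {a} → a ℕ.≤ b → Step B P (R′ a) (Q a) (Q (next a))
    step {a} a≤b with ℕ.m≤n⇒m<n∨m≡n a≤b
    ... | inj₁ a<b  = subst₂ (λ r′ a′ → Step B P r′ (Q a) (Q a′))
                             (sym (R′-< a<b)) (sym (next-< a<b)) (Q-step a<b)
    ... | inj₂ refl = subst₂ (λ r′ a′ → Step B P r′ (Q b) (Q a′))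
                             (sym R′-last) (sym next-last) closing-step

    last-move-≢-r : ∀ {a} → suc a ≡ b → R a ≢ r
    last-move-≢-r {zero}  1≡b _ = contradiction (subst (2 ℕ.≤_) (sym 1≡b) 2≤b) λ { (s≤s ()) }
    last-move-≢-r {suc a} a+2≡b R[a+1]≡r = step-line-has-no-third-point a+1<b z≤n (λ ()) (λ ())
      (Attack-trans P (Attack-sym P back-attack) (Step⇒Attack B P (Q-step a+1<b)))
      where
      a+1<b : suc a ℕ.< b
      a+1<b = ℕ.≤-reflexive a+2≡b
      back-attack : Attack P (R (suc a)) (Q (suc (suc a))) (Q 0)
      back-attack = subst₂ (λ r′ a′ → Attack P r′ (Q a′) (Q 0)) (sym R[a+1]≡r) (sym a+2≡b)
                           (proj₂ (proj₂ closing))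

    alternating : ∀ {a} → a ℕ.≤ b → R′ (next a) ≢ R′ a
    alternating a≤b with ℕ.m≤n⇒m<n∨m≡n a≤b
    ... | inj₂ refl = subst₂ _≢_ (sym (trans (cong R′ next-last) (R′-< (ℕ.<-trans (s≤s z≤n) 2≤b))))
                                 (sym R′-last) (r≢R[0] ∘ sym)
    ... | inj₁ a<b with ℕ.m≤n⇒m<n∨m≡n a<b
    ...   | inj₁ a+1<b = subst₂ _≢_ (sym (trans (cong R′ (next-< a<b)) (R′-< a+1<b)))
                                    (sym (R′-< a<b)) (R-alternates a+1<b)
    ...   | inj₂ a+1≡b = subst₂ _≢_ (sym (trans (cong R′ (trans (next-< a<b) a+1≡b)) R′-last))
                                    (sym (R′-< a<b)) (last-move-≢-r a+1≡b ∘ sym)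

    cyclical : IsCyclical B P (suc b) T
    cyclical = closed-walk⇒IsCyclical B P Q R′ (ℕ.<⇒≤ 2≤b) step alternating Q-injective T (sym ∘ T≡Q∘toℕ)

  closesThroughInterior⇒IsCyclical : ClosesThroughInterior → IsCyclical B P (suc b) T
  closesThroughInterior⇒IsCyclical (r , closing , interior) = Closed.cyclical r closing interior

proposition5p7 : (B : Polygon) (P : Rider) (l : ℕ) (T : Fin l → Point) →
    IsTrajectory B P l T → FullRank B P l T →
    IsCornerTrajectory B P l T ⊎ IsRigidCycle B P l T
proposition5p7 B P zero    T (() , _)
proposition5p7 B P (suc b) T (_ , T-injective , E , k , T⊆E) full =
  Sum.map₂ rigid (corner⊎parallel B T T⊆B)
  where
  open Trajectory B P T-injective E k T⊆E
  T⊆B : ∀ i → InB B (T i)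
  T⊆B i = proj₁ (subst (Boundary B) (sym (T≡Q∘toℕ i)) (Q-boundary (toℕ≤b i)))
  rigid : (∀ i → ParallelTightSides B (T i)) → IsRigidCycle B P (suc b) T
  rigid parallel = closesThroughInterior⇒IsCyclical (full-rank⇒closesThroughInterior parallel full) , full
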